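{- Let $K_n$ be the complete graph on $n\geq 3$ vertices. Then $\theta(K_n)=1$.
   Context: For a positive integer $t$, $G^{t}$ has vertex set $V(G)$, with $u,v$ adjacent iff there is a walk of length $t$ between them in $G$. $S_t(G)$ replaces each edge by a path with exactly $t-1$ inner vertices, and $G^{\frac{2r+1}{2s+1}}:=(S_{2s+1}(G))^{2r+1}$ for non-negative integers $r,s$. $og(G)$ is the odd girth. For a non-bipartite graph $G$, $\theta(G):=\sup\{\frac{2r+1}{2s+1}: r,s\ge 0 \text{ integers},\ \chi(G^{\frac{2r+1}{2s+1}})\le\chi(G),\ \frac{2r+1}{2s+1}<og(G)\}$. -}

module Defs where

open import Data.Nat using (ℕ; zero; suc; _+_; _*_; _∸_; _≤_)

open import Data.Fin using (Fin; toℕ; inject₁; fromℕ; _≟_) renaming (_<_ to _<ᶠ_; zero to fzero; suc to fsuc)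
open import Data.Bool using (Bool; true; false; not)
open import Data.Integer using (+_)
open import Data.Rational using (ℚ; _/_) renaming (_≤_ to _≤ℚ_; _<_ to _<ℚ_)
open import Data.Product using (Σ; ∃; _×_; _,_)
open import Data.Sum using (_⊎_)
open import Relation.Nullary using (¬_)
open import Relation.Nullary.Decidable using (⌊_⌋)
open import Relation.Binary.PropositionalEquality using (_≡_; _≢_)
open import Function.Definitions using (Injective)

Odd : ℕ → Set
Odd ℓ = Σ ℕ λ k → ℓ ≡ suc (2 * k)

Graph : ℕ → Set
Graph n = Fin n → Fin n → Bool

K : (n : ℕ) → Graph n
K n u v = not ⌊ u ≟ v ⌋

data Walk {V : Set} (R : V → V → Set) : ℕ → V → V → Set where
  here : ∀ {u} → Walk R zero u u
  step : ∀ {k u v w} → R u v → Walk R k v w → Walk R (suc k) u w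

Power : {V : Set} → (V → V → Set) → ℕ → V → V → Set
Power R t u v = Walk R t u v

-- Proper colouring with k colours; χ(H) ≤ χ(G) is expressed as
-- "every k such that G is k-colourable makes H k-colourable".
Colorable : {V : Set} → (V → V → Set) → ℕ → Set
Colorable {V} R k = Σ (V → Fin k) λ c → ∀ u v → R u v → c u ≢ c v

ChiLe : {V W : Set} → (V → V → Set) → (W → W → Set) → Set
ChiLe H G = ∀ k → Colorable G k → Colorable H k

-- Subdivision S_t(G): each edge {u,v} (u < v) is replaced by the path
-- u, (u,v,0), (u,v,1), ..., (u,v,t-2), v  with t-1 inner vertices.
data SVert {n : ℕ} (G : Graph n) (t : ℕ) : Set where
  orig  : Fin n → SVert G t
  inner : (u v : Fin n) → u <ᶠ v → G u v ≡ true → Fin (t ∸ 1) → SVert G t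

data SArc {n : ℕ} (G : Graph n) (t : ℕ) : SVert G t → SVert G t → Set where
  oo : ∀ {u v} → t ≡ 1 → u <ᶠ v → G u v ≡ true → SArc G t (orig u) (orig v)
  ui : ∀ {u v p e i} → toℕ i ≡ 0 → SArc G t (orig u) (inner u v p e i)
  ii : ∀ {u v p e i j} → toℕ j ≡ suc (toℕ i) → SArc G t (inner u v p e i) (inner u v p e j)
  iv : ∀ {u v p e i} → suc (toℕ i) ≡ t ∸ 1 → SArc G t (inner u v p e i) (orig v)

SAdj : {n : ℕ} (G : Graph n) (t : ℕ) → SVert G t → SVert G t → Set
SAdj G t x y = SArc G t x y ⊎ SArc G t y x

-- G^{(2r+1)/(2s+1)} := (S_{2s+1}(G))^{2r+1}
FracPower : {n : ℕ} (G : Graph n) (r s : ℕ) → SVert G (suc (2 * s)) → SVert G (suc (2 * s)) → Set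
FracPower G r s = Power (SAdj G (suc (2 * s))) (suc (2 * r))

Adj : {n : ℕ} → Graph n → Fin n → Fin n → Set
Adj G u v = G u v ≡ true

IsCycle : {n : ℕ} → Graph n → (m : ℕ) → (Fin (suc m) → Fin n) → Set
IsCycle G m c = (2 ≤ m) × Injective _≡_ _≡_ c
  × (∀ (i : Fin m) → Adj G (c (inject₁ i)) (c (fsuc i)))
  × Adj G (c (fromℕ m)) (c fzero)

HasCycleOfLength : {n : ℕ} → Graph n → ℕ → Set
HasCycleOfLength {n} G ℓ = Σ ℕ λ m → (suc m ≡ ℓ) × Σ (Fin (suc m) → Fin n) (IsCycle G m)

IsOddGirth : {n : ℕ} → Graph n → ℕ → Set
IsOddGirth G g = Odd g × HasCycleOfLength G g
  × (∀ ℓ → Odd ℓ → HasCycleOfLength G ℓ → g ≤ ℓ)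

ThetaSet : {n : ℕ} → Graph n → ℚ → Set
ThetaSet G x = Σ ℕ λ r → Σ ℕ λ s →
  (x ≡ (+ suc (2 * r)) / suc (2 * s))
  × ChiLe (FracPower G r s) (Adj G)
  × (∀ g → IsOddGirth G g → x <ℚ ((+ g) / 1))

IsSup : (ℚ → Set) → ℚ → Set
IsSup P q = (∀ x → P x → x ≤ℚ q) × (∀ b → (∀ x → P x → x ≤ℚ b) → q ≤ℚ b)

-- θ(K_n) ≥ 1 because (2·0+1)/(2·0+1) = 1 is admissible: S_1(K_n)^1 is K_n
-- itself, and every cycle has length at least 3 > 1.  For θ(K_n) ≤ 1 one shows that for
-- s < r the graph S_{2s+1}(K_n)^{2r+1} has no proper n-colouring c.  The n branch
-- vertices are pairwise joined by walks of length 2s+1, so they use all n colours.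
-- Then, by induction on k ≤ s, the vertex at distance 2k from u on the subdivided edge
-- uv has the colour of u: it is joined by a walk of length 2s+3 to the vertex at
-- distance 2k-2 from every other w on the edge wu, which by induction has the colour of
-- w, so only the colour of u is left.  Finally, for a triangle u, v, w the vertices at
-- distance 2s from u on uv and on uw share the colour of u, yet are joined by the walk
-- of length 1 + (2s+1) + 1 through v and w.
module Submission where

open import Defs
open import Data.Nat using (ℕ; _≤_)
open import Data.Rational using (1ℚ)

open import Data.Nat
  using (zero; suc; _+_; _*_; _∸_; _<_; _≤′_; ≤′-refl; ≤′-step; z≤n; s≤s; _<?_; _≤?_)
open import Data.Nat.Properties
  using (<-irrefl; *-suc; +-suc; +-comm; +-identityʳ; ≤-refl; ≤-trans; ≤-reflexive; ≤-antisym; <-≤-trans; <⇒≤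
        ; n≤1+n; n<1+n; m<n+m; ≮⇒≥; ≰⇒>; n≤0⇒n≡0; *-monoʳ-≤; ≤⇒≤′; n∸n≡0; m∸n≤m
        ; m+[n∸m]≡n; m∸[m∸n]≡n; m+n∸n≡m)
open import Data.Fin using (Fin; fromℕ<; _≟_) renaming (zero to fzero; suc to fsuc; _<_ to _<ᶠ_)
open import Data.Fin.Properties using (any?; toℕ-fromℕ<; <⇒notInjective)
  renaming (<-cmp to <ᶠ-cmp; <-irrefl to <ᶠ-irrefl; <-asym to <ᶠ-asym; <-irrelevant to <ᶠ-irrelevant)
open import Data.Integer using (+_; +≤+; +<+) renaming (_≤_ to _≤ℤ_; _<_ to _<ℤ_)
open import Data.Integer.Properties using (*-identityʳ; *-identityˡ)
open import Data.Rational using (_/_; toℚᵘ) renaming (_≤_ to _≤ℚ_; _<_ to _<ℚ_)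
open import Data.Rational.Properties using (toℚᵘ-cancel-≤; toℚᵘ-cancel-<; toℚᵘ-fromℚᵘ)
open import Data.Rational.Unnormalised using (mkℚᵘ; *≤*; *<*) renaming (_≃_ to _≃ᵘ_)
open import Data.Rational.Unnormalised.Properties using (≤-respˡ-≃; <-respʳ-≃; ≃-sym)
open import Data.Product using (∃; _,_)
open import Data.Sum using (inj₁; inj₂)
open import Data.Empty using (⊥; ⊥-elim)
open import Function using (_∘_)
open import Function.Definitions using (Injective)
open import Relation.Nullary using (¬_; yes; no; contradiction)
open import Relation.Binary.Definitions using (Symmetric; tri<; tri≈; tri>)
open import Relation.Binary.PropositionalEquality
  using (_≡_; _≢_; refl; sym; trans; cong; subst; subst₂; module ≡-Reasoning)

injective⇒surjective : ∀ {n} {f : Fin n → Fin n} → Injective _≡_ _≡_ f → ∀ y → ∃ λ x → f x ≡ y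
injective⇒surjective {n} {f} f-injective y with any? (λ x → f x ≟ y)
... | yes hit = hit
... | no miss = ⊥-elim (<⇒notInjective (n<1+n n) y∷f-injective)
  where
    y∷f : Fin (suc n) → Fin n
    y∷f fzero = y
    y∷f (fsuc x) = f x

    y∷f-injective : Injective _≡_ _≡_ y∷f
    y∷f-injective {fzero} {fzero} _ = refl
    y∷f-injective {fzero} {fsuc x} y≡fx = ⊥-elim (miss (x , sym y≡fx))
    y∷f-injective {fsuc x} {fzero} fx≡y = ⊥-elim (miss (x , fx≡y))
    y∷f-injective {fsuc x} {fsuc x′} fx≡fx′ = cong fsuc (f-injective fx≡fx′)

module _ {V : Set} {R : V → V → Set} where

  _++ʷ_ : ∀ {a b x y z} → Walk R a x y → Walk R b y z → Walk R (a + b) x z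
  here ++ʷ w = w
  step e w ++ʷ w′ = step e (w ++ʷ w′)

  _∷ʳ_ : ∀ {a x y z} → Walk R a x y → R y z → Walk R (suc a) x z
  here ∷ʳ e = step e here
  step e w ∷ʳ e′ = step e (w ∷ʳ e′)

module SymmetricWalk {V : Set} {R : V → V → Set} (R-sym : Symmetric R) where

  reverse : ∀ {a x y} → Walk R a x y → Walk R a y x
  reverse here = here
  reverse (step e w) = reverse w ∷ʳ R-sym e

  bounce : ∀ {l x y} → Walk R (suc l) x y → Walk R (suc (suc (suc l))) x y
  bounce (step e w) = step e (step (R-sym e) (step e w))

  lengthen-odd : ∀ {j r x y} → j ≤ r → Walk R (suc (2 * j)) x y → Walk R (suc (2 * r)) x y
  lengthen-odd j≤r = go (≤⇒≤′ j≤r)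
    where
      go : ∀ {j r x y} → j ≤′ r → Walk R (suc (2 * j)) x y → Walk R (suc (2 * r)) x y
      go ≤′-refl w = w
      go {r = suc r} {x} {y} (≤′-step j≤′r) w =
        subst (λ L → Walk R (suc L) x y) (sym (*-suc 2 r)) (bounce (go j≤′r w))

K-adj⇒≢ : ∀ {n} {u v : Fin n} → Adj (K n) u v → u ≢ v
K-adj⇒≢ {u = u} adj refl with u ≟ u
K-adj⇒≢ () refl | yes _
... | no u≢u = u≢u refl

≢⇒K-adj : ∀ {n} {u v : Fin n} → u ≢ v → Adj (K n) u v
≢⇒K-adj {u = u} {v} u≢v with u ≟ v
... | yes u≡v = contradiction u≡v u≢v
... | no _ = refl

<⇒K-adj : ∀ {n} {u v : Fin n} → u <ᶠ v → Adj (K n) u v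
<⇒K-adj u<v = ≢⇒K-adj (λ u≡v → <ᶠ-irrefl u≡v u<v)

K-colorable : ∀ n → Colorable (Adj (K n)) n
K-colorable n = (λ u → u) , λ _ _ → K-adj⇒≢

module SubdividedEdge (n m : ℕ) where

  t : ℕ
  t = suc m

  V : Set
  V = SVert (K n) t

  A : V → V → Set
  A = SAdj (K n) t

  A-sym : Symmetric A
  A-sym (inj₁ a) = inj₂ a
  A-sym (inj₂ a) = inj₁ a

  open SymmetricWalk {V} {A} A-sym public

  -- Vertex j of the path a, (a,b,0), …, (a,b,m-1), b; every j ≥ t gives b.
  edgeVertex : (a b : Fin n) → a <ᶠ b → ℕ → V
  edgeVertex a b a<b zero = orig a
  edgeVertex a b a<b (suc j) with j <? m
  ... | yes j<m = inner a b a<b (<⇒K-adj a<b) (fromℕ< j<m)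
  ... | no _ = orig b

  edgeVertex-end : ∀ a b a<b → edgeVertex a b a<b t ≡ orig b
  edgeVertex-end a b a<b with m <? m
  ... | yes m<m = contradiction m<m (<-irrefl refl)
  ... | no _ = refl

  edgeVertex-step : ∀ a b a<b j → j < t → A (edgeVertex a b a<b j) (edgeVertex a b a<b (suc j))
  edgeVertex-step a b a<b zero _ with 0 <? m
  ... | yes 0<m = inj₁ (ui (toℕ-fromℕ< 0<m))
  ... | no 0≮m = inj₁ (oo (cong suc (n≤0⇒n≡0 (≮⇒≥ 0≮m))) a<b (<⇒K-adj a<b))
  edgeVertex-step a b a<b (suc j) (s≤s j<m) with j <? m | suc j <? m
  ... | no j≮m | _ = contradiction j<m j≮m
  ... | yes j<m′ | yes 1+j<m =
    inj₁ (ii (trans (toℕ-fromℕ< 1+j<m) (cong suc (sym (toℕ-fromℕ< j<m′)))))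
  ... | yes j<m′ | no 1+j≮m =
    inj₁ (iv (trans (cong suc (toℕ-fromℕ< j<m′)) (≤-antisym j<m (≮⇒≥ 1+j≮m))))

  edgeVertex-walk : ∀ a b a<b d i → d + i ≤ t →
                    Walk A d (edgeVertex a b a<b i) (edgeVertex a b a<b (d + i))
  edgeVertex-walk a b a<b zero i _ = here
  edgeVertex-walk a b a<b (suc d) i d+i<t =
    step (edgeVertex-step a b a<b i (<-≤-trans (m<n+m i (s≤s z≤n)) d+i<t))
      (subst (Walk A d (edgeVertex a b a<b (suc i)) ∘ edgeVertex a b a<b) (+-suc d i)
        (edgeVertex-walk a b a<b d (suc i) (subst (_≤ t) (sym (+-suc d i)) d+i<t)))

  -- The vertex at distance d from u on the subdivided edge uw (junk orig u when u ≡ w).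
  onEdge : Fin n → Fin n → ℕ → V
  onEdge u w d with <ᶠ-cmp u w
  ... | tri< u<w _ _ = edgeVertex u w u<w d
  ... | tri≈ _ _ _ = orig u
  ... | tri> _ _ w<u = edgeVertex w u w<u (t ∸ d)

  onEdge-zero : ∀ u w → onEdge u w 0 ≡ orig u
  onEdge-zero u w with <ᶠ-cmp u w
  ... | tri< _ _ _ = refl
  ... | tri≈ _ _ _ = refl
  ... | tri> _ _ w<u = edgeVertex-end w u w<u

  onEdge-flip : ∀ u w d → u ≢ w → d ≤ t → onEdge u w d ≡ onEdge w u (t ∸ d)
  onEdge-flip u w d u≢w d≤t with <ᶠ-cmp u w | <ᶠ-cmp w u
  ... | tri< u<w _ _ | tri> _ _ u<w′ =
    trans (cong (λ p → edgeVertex u w p d) (<ᶠ-irrelevant u<w u<w′))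
          (cong (edgeVertex u w u<w′) (sym (m∸[m∸n]≡n d≤t)))
  ... | tri> _ _ w<u | tri< w<u′ _ _ = cong (λ p → edgeVertex w u p (t ∸ d)) (<ᶠ-irrelevant w<u w<u′)
  ... | tri≈ _ u≡w _ | _ = contradiction u≡w u≢w
  ... | _ | tri≈ _ w≡u _ = contradiction (sym w≡u) u≢w
  ... | tri< u<w _ _ | tri< w<u _ _ = ⊥-elim (<ᶠ-asym u<w w<u)
  ... | tri> _ _ w<u | tri> _ _ u<w = ⊥-elim (<ᶠ-asym u<w w<u)

  onEdge-end : ∀ u w → u ≢ w → onEdge u w t ≡ orig w
  onEdge-end u w u≢w =
    trans (onEdge-flip u w t u≢w ≤-refl) (trans (cong (onEdge w u) (n∸n≡0 t)) (onEdge-zero w u))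

  walk-to-onEdge : ∀ u w d → u ≢ w → d ≤ t → Walk A d (orig u) (onEdge u w d)
  walk-to-onEdge u w d u≢w d≤t with <ᶠ-cmp u w
  ... | tri< u<w _ _ =
    subst (Walk A d (orig u) ∘ edgeVertex u w u<w) (+-identityʳ d)
      (edgeVertex-walk u w u<w d 0 (subst (_≤ t) (sym (+-identityʳ d)) d≤t))
  ... | tri≈ _ u≡w _ = contradiction u≡w u≢w
  ... | tri> _ _ w<u =
    reverse (subst (Walk A d (edgeVertex w u w<u (t ∸ d))) (trans (cong (edgeVertex w u w<u) (m+[n∸m]≡n d≤t)) (edgeVertex-end w u w<u))
      (edgeVertex-walk w u w<u d (t ∸ d) (≤-reflexive (m+[n∸m]≡n d≤t))))

  walk-between-origins : ∀ u w → u ≢ w → Walk A t (orig u) (orig w)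
  walk-between-origins u w u≢w = subst (Walk A t (orig u)) (onEdge-end u w u≢w) (walk-to-onEdge u w t u≢w ≤-refl)

  walk-via-origin : ∀ u v w d e → u ≢ v → u ≢ w → d ≤ t → e ≤ t →
                    Walk A (d + e) (onEdge u v d) (onEdge u w e)
  walk-via-origin u v w d e u≢v u≢w d≤t e≤t =
    reverse (walk-to-onEdge u v d u≢v d≤t) ++ʷ walk-to-onEdge u w e u≢w e≤t

module ProperColouring (n s r : ℕ) (s<r : s < r)
  (c : SVert (K n) (suc (2 * s)) → Fin n)
  (proper : ∀ x y → FracPower (K n) r s x y → c x ≢ c y) where

  open SubdividedEdge n (2 * s)

  walk⇒colours-differ : ∀ {L x y} j → L ≡ suc (2 * j) → j ≤ r → Walk A L x y → c x ≢ c y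
  walk⇒colours-differ j refl j≤r w = proper _ _ (lengthen-odd j≤r w)

  origin-colouring-injective : Injective _≡_ _≡_ (c ∘ orig)
  origin-colouring-injective {u} {w} cu≡cw with u ≟ w
  ... | yes u≡w = u≡w
  ... | no u≢w =
    contradiction cu≡cw (walk⇒colours-differ s refl (<⇒≤ s<r) (walk-between-origins u w u≢w))

  2*-≤-t : ∀ {k} → k ≤ s → 2 * k ≤ t
  2*-≤-t k≤s = ≤-trans (*-monoʳ-≤ 2 k≤s) (n≤1+n (2 * s))

  even-point-avoids : ∀ k → suc k ≤ s → ∀ u v w → u ≢ v → w ≢ u →
                      c (onEdge w u (2 * k)) ≡ c (orig w) →
                      c (onEdge u v (2 * suc k)) ≢ c (orig w)
  even-point-avoids k 1+k≤s u v w u≢v w≢u c-wu≡c-w c-uv≡c-w =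
    walk⇒colours-differ (suc s) length s<r walk (trans c-uv≡c-w (sym c-wu≡c-w))
    where
      2k≤t : 2 * k ≤ t
      2k≤t = 2*-≤-t (≤-trans (n≤1+n k) 1+k≤s)

      walk : Walk A (2 * suc k + (t ∸ 2 * k)) (onEdge u v (2 * suc k)) (onEdge w u (2 * k))
      walk = subst (Walk A _ _)
        (trans (onEdge-flip u w (t ∸ 2 * k) (w≢u ∘ sym) (m∸n≤m t (2 * k)))
               (cong (onEdge w u) (m∸[m∸n]≡n 2k≤t)))
        (walk-via-origin u v w (2 * suc k) (t ∸ 2 * k) u≢v (w≢u ∘ sym) (2*-≤-t 1+k≤s) (m∸n≤m t (2 * k)))

      length : 2 * suc k + (t ∸ 2 * k) ≡ suc (2 * suc s)
      length = let open ≡-Reasoning in begin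
        2 * suc k + (t ∸ 2 * k)    ≡⟨ cong (_+ (t ∸ 2 * k)) (*-suc 2 k) ⟩
        2 + (2 * k + (t ∸ 2 * k))  ≡⟨ cong (λ x → 2 + x) (m+[n∸m]≡n 2k≤t) ⟩
        2 + t                      ≡⟨ cong suc (sym (*-suc 2 s)) ⟩
        suc (2 * suc s)            ∎

  -- The origins use all n colours, so a vertex avoiding every colour but that of u has it.
  even-point-colour : ∀ k → k ≤ s → ∀ u v → u ≢ v → c (onEdge u v (2 * k)) ≡ c (orig u)
  even-point-colour zero _ u v _ = cong c (onEdge-zero u v)
  even-point-colour (suc k) 1+k≤s u v u≢v
    with w , c-w≡ ← injective⇒surjective origin-colouring-injective (c (onEdge u v (2 * suc k)))
    with w ≟ u
  ... | yes refl = sym c-w≡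
  ... | no w≢u = contradiction (sym c-w≡)
    (even-point-avoids k 1+k≤s u v w u≢v w≢u
      (even-point-colour k (≤-trans (n≤1+n k) 1+k≤s) w u w≢u))

  triangle-absurd : ∀ u v w → u ≢ v → v ≢ w → u ≢ w → ⊥
  triangle-absurd u v w u≢v v≢w u≢w =
    walk⇒colours-differ (suc s) length s<r walk
      (trans (even-point-colour s ≤-refl u v u≢v) (sym (even-point-colour s ≤-refl u w u≢w)))
    where
      near-v : onEdge u v (2 * s) ≡ onEdge v u 1
      near-v = trans (onEdge-flip u v (2 * s) u≢v (n≤1+n (2 * s))) (cong (onEdge v u) (m+n∸n≡m 1 (2 * s)))

      near-w : onEdge w u 1 ≡ onEdge u w (2 * s)
      near-w = onEdge-flip w u 1 (u≢w ∘ sym) (s≤s z≤n)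

      walk : Walk A (1 + (t + 1)) (onEdge u v (2 * s)) (onEdge u w (2 * s))
      walk = subst₂ (Walk A _) (sym near-v) near-w
        (reverse (walk-to-onEdge v u 1 (u≢v ∘ sym) (s≤s z≤n))
          ++ʷ (walk-between-origins v w v≢w ++ʷ walk-to-onEdge w u 1 (u≢w ∘ sym) (s≤s z≤n)))

      length : 1 + (t + 1) ≡ suc (2 * suc s)
      length = cong suc (trans (+-comm t 1) (sym (*-suc 2 s)))

FracPower-K-not-colorable : ∀ {n r s} → 3 ≤ n → s < r → ¬ Colorable (FracPower (K n) r s) n
FracPower-K-not-colorable {suc (suc (suc _))} {r} {s} (s≤s (s≤s (s≤s _))) s<r (c , proper) =
  ProperColouring.triangle-absurd _ s r s<r c proper
    fzero (fsuc fzero) (fsuc (fsuc fzero)) (λ ()) (λ ()) (λ ())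

FracPower-0-0-chiLe : ∀ {n} (G : Graph n) → ChiLe (FracPower G 0 0) (Adj G)
FracPower-0-0-chiLe G k (c , proper) = c′ , proper′
  where
    c′ : SVert G 1 → Fin k
    c′ (orig u) = c u
    c′ (inner _ _ _ _ ())

    proper′ : ∀ x y → FracPower G 0 0 x y → c′ x ≢ c′ y
    proper′ (inner _ _ _ _ ()) _ _
    proper′ _ (inner _ _ _ _ ()) _
    proper′ (orig u) (orig v) (step (inj₁ (oo _ _ uv)) here) = proper u v uv
    proper′ (orig u) (orig v) (step (inj₂ (oo _ _ vu)) here) = proper v u vu ∘ sym

cycle-length-≥3 : ∀ {n} {G : Graph n} {ℓ} → HasCycleOfLength G ℓ → 3 ≤ ℓ
cycle-length-≥3 (_ , refl , _ , 2≤m , _) = s≤s 2≤m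

toℚᵘ-/ : ∀ i d → toℚᵘ (i / suc d) ≃ᵘ mkℚᵘ i d
toℚᵘ-/ i d = toℚᵘ-fromℚᵘ (mkℚᵘ i d)

m≤n⇒m/n≤1 : ∀ {m d} → m ≤ suc d → + m / suc d ≤ℚ 1ℚ
m≤n⇒m/n≤1 {m} {d} m≤n = toℚᵘ-cancel-≤ (≤-respˡ-≃ (≃-sym (toℚᵘ-/ (+ m) d))
  (*≤* (subst₂ _≤ℤ_ (sym (*-identityʳ (+ m))) (sym (*-identityˡ (+ suc d))) (+≤+ m≤n))))

1<m⇒1<m/1 : ∀ {m} → 1 < m → 1ℚ <ℚ + m / 1
1<m⇒1<m/1 {m} 1<m = toℚᵘ-cancel-< (<-respʳ-≃ (≃-sym (toℚᵘ-/ (+ m) 0))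
  (*<* (subst (_<ℤ_ _) (sym (*-identityʳ (+ m))) (+<+ 1<m))))

corollary3p6 : (n : ℕ) → 3 ≤ n → IsSup (ThetaSet (K n)) 1ℚ
corollary3p6 n 3≤n = upper , least
  where
    upper : ∀ x → ThetaSet (K n) x → x ≤ℚ 1ℚ
    upper _ (r , s , refl , χ≤ , _) with r ≤? s
    ... | yes r≤s = m≤n⇒m/n≤1 (s≤s (*-monoʳ-≤ 2 r≤s))
    ... | no r≰s = ⊥-elim (FracPower-K-not-colorable 3≤n (≰⇒> r≰s) (χ≤ n (K-colorable n)))

    1<og : ∀ g → IsOddGirth (K n) g → 1ℚ <ℚ + g / 1
    1<og g (_ , cycle , _) = 1<m⇒1<m/1 (≤-trans (s≤s (s≤s z≤n)) (cycle-length-≥3 {G = K n} cycle))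

    least : ∀ b → (∀ x → ThetaSet (K n) x → x ≤ℚ b) → 1ℚ ≤ℚ b
    least b bound = bound 1ℚ (0 , 0 , refl , FracPower-0-0-chiLe (K n) , 1<og)
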